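{- Let $2\le i\le s-1$ and let $\mu=(\mu_1,\dots,\mu_s)\vdash n$ with $\mu_{i-1}>\mu_i$. Then $$f(\mu(i,s))-f(\mu)=(2\mu_i-2\mu_s+s-i+2)f(\mu^{\uparrow i}-\hat{1})-(2\mu_i+s-i)f(\mu-\hat{1})+2(\mu_s-1)f(\mu(i,s)-\hat{1}).$$
   Context: Partitions are non-increasing sequences of positive integers; $\lambda\vdash n$ means the parts sum to $n$. For $\lambda=(\lambda_1,\dots,\lambda_r)$: $\lambda\setminus\lambda_r:=(\lambda_1,\dots,\lambda_{r-1})$; for $1\le k\le\lambda_r$, $\lambda-\hat{k}:=(\lambda_1-k,\dots,\lambda_r-k)$; zero parts are deleted and the all-zero sequence is identified with $(0)$. For $\mu$ of length $s$ with $\mu_{i-1}>\mu_i$, $\mu^{\uparrow i}$ replaces $\mu_i$ by $\mu_i+1$; $\mu(i,s)$ is obtained from $\mu^{\uparrow i}$ by replacing its last part $\mu_s$ by $\mu_s-1$ (deleting it if it becomes $0$). Define $d_0=1$, $d_1=0$, $d_n=2(n-1)(d_{n-1}+d_{n-2})$ for $n\ge2$. Define $f$ on partitions recursively: $f((0))=1$; $f((n))=d_n$ for $n\ge1$; and for $\lambda=(\lambda_1,\dots,\lambda_r)$ with $r\ge2$, $f(\lambda)=f(\lambda\setminus\lambda_r)+\sum_{k=1}^{\lambda_r}\binom{\lambda_r}{k}(2k-1)!!\,f(\lambda\setminus\lambda_r-\hat{k})$. -}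

module Defs where

open import Data.Nat using (ℕ; zero; suc; _+_; _*_; _∸_; _≥_; _<_; _≤?_)
open import Data.Nat.Combinatorics using (_C_)
open import Data.List using (List; []; _∷_; map; filter; reverse; length)
open import Data.List.Relation.Unary.All using (All)
open import Data.List.Relation.Unary.Linked using (Linked)

-- Partitions are represented as lists of naturals λ₁ ∷ … ∷ λᵣ ∷ [].
-- The partition (0) is represented by the empty list [].
IsPartition : List ℕ → Set
IsPartition μ = Linked _≥_ μ × All (0 <_) μ
  where open import Data.Product using (_×_)

d : ℕ → ℕ
d zero = 1
d (suc zero) = 0
d (suc (suc n)) = 2 * (suc n) * (d (suc n) + d n)

-- double factorial (2k-1)!!  (with (-1)!! = 1)
oddFact : ℕ → ℕ
oddFact zero = 1
oddFact (suc k) = (2 * k + 1) * oddFact k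

sumFrom1 : ℕ → (ℕ → ℕ) → ℕ
sumFrom1 zero h = 0
sumFrom1 (suc n) h = sumFrom1 n h + h (suc n)

dropZeros : List ℕ → List ℕ
dropZeros = filter (λ x → 1 ≤? x)

minusHat : ℕ → List ℕ → List ℕ
minusHat k λs = dropZeros (map (λ x → x ∸ k) λs)

-- auxiliary: f on the REVERSED list (last part first), with fuel
fRev : ℕ → List ℕ → ℕ
fRev _ [] = 1
fRev _ (n ∷ []) = d n
fRev zero (_ ∷ _ ∷ _) = 0
fRev (suc m) (x ∷ y ∷ r) =
  fRev m (y ∷ r) + sumFrom1 x (λ k → (x C k) * oddFact k * fRev m (minusHat k (y ∷ r)))

-- f(λ); the fuel length λ suffices since each recursive call shortens the list
f : List ℕ → ℕ
f λs = fRev (length λs) (reverse λs)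

-- μ_j (1-based; 0 if out of range)
part : List ℕ → ℕ → ℕ
part [] _ = 0
part (x ∷ xs) zero = 0
part (x ∷ xs) (suc zero) = x
part (x ∷ xs) (suc (suc j)) = part xs (suc j)

-- μ^{↑i} : add 1 to the i-th part (1-based)
up : List ℕ → ℕ → List ℕ
up [] _ = []
up (x ∷ xs) zero = x ∷ xs
up (x ∷ xs) (suc zero) = suc x ∷ xs
up (x ∷ xs) (suc (suc j)) = x ∷ up xs (suc j)

decLast : List ℕ → List ℕ
decLast [] = []
decLast (x ∷ []) = (x ∸ 1) ∷ []
decLast (x ∷ y ∷ r) = x ∷ decLast (y ∷ r)

-- μ(i,s): from μ^{↑i}, replace last part μ_s by μ_s - 1, deleting it if 0
muIS : List ℕ → ℕ → List ℕ
muIS μ i = dropZeros (decLast (up μ i))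

module Submission where

-- Expanding f in the last part gives f(η, x) = Σ_{k ≤ x} C(x,k) (2k−1)!! f(η − k̂). For these weights
-- Pascal's rule reads C(x+1,k+1)(2k+1)!! = C(x,k+1)(2k+1)!! + (2k+1)·C(x,k)(2k−1)!!, and together
-- with absorption k C(m,k) = m C(m−1,k−1) it yields the identity for raising the last part,
--   f(η, x+1) − f(η, x) = (2x+1) f((η, x+1) − 1̂) − 2x f((η, x) − 1̂).
-- Raising an inner part i of a partition ν of length ℓ satisfies
--   f(ν↑i) − f(ν) = (A+1) f(ν↑i − 1̂) − A f(ν − 1̂),   A = 2ν_i + ℓ − i,
-- by induction on ℓ: writing ν = (η, x) and expanding in x, the k-th terms are instances of the same
-- identity for the shorter partitions η − k̂ (k < x), and Pascal's rule recombines them. As μ(i,s) is μ↑i with its last part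
-- lowered, the theorem is the difference of the identity for μ↑i against μ and the one for μ↑i
-- against μ(i,s).

open import Defs
open import Data.Nat using (ℕ; zero; suc; _≤_; _<_; _∸_; _≥_; _≤?_; z≤n; s≤s)
import Data.Nat as ℕ
open import Data.Nat.Properties
  using (≤-refl; ≤-trans; ≤-reflexive; <⇒≤; ≤-pred; n<1+n; m<n⇒m<1+n; m≤n⇒m<n∨m≡n; 0∸n≡0; ∸-+-assoc;
         m<n⇒0<n∸m; m∸n≤m; +-∸-assoc; n≤1+n; ∸-monoˡ-≤; ∸-monoˡ-<; suc-injective;
         +-comm; +-identityʳ; *-identityʳ; *-zeroʳ; *-distribˡ-+)
import Data.Nat.Tactic.RingSolver as ℕ-Solver
open import Data.Nat.ListAction using (sum)
open import Data.Nat.Combinatorics using (_C_; nCk+nC[k+1]≡[n+1]C[k+1]; nC1≡n; k>n⇒nCk≡0)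
open import Data.Integer using (ℤ; +_; _+_; _-_; _*_; -_)
open import Data.Integer.Properties
  using (+-0-commutativeMonoid; +-*-semiring; +-assoc; ⊖-≥; m-n≡m⊖n; *-identityˡ; pos-+; pos-*; neg-distribˡ-*)
  renaming (+-identityʳ to +ℤ-identityʳ)
open import Data.Integer.Tactic.RingSolver using (solve-∀)
open import Data.Fin using (Fin; toℕ; fromℕ; inject₁)
open import Data.Fin.Properties using (toℕ-inject₁; toℕ-fromℕ; toℕ≤pred[n])
open import Algebra.Properties.CommutativeMonoid.Sum +-0-commutativeMonoid
  using (sum⁺-syntax; sum-cong-≗; sum-init-last; ∑-distrib-+) renaming (sum to ∑)
open import Algebra.Properties.Semiring.Sum +-*-semiring using (*-distribˡ-sum)
open import Data.List using (List; []; _∷_; [_]; _++_; _∷ʳ_; length; map; filter; reverse; initLast; _∷ʳ′_)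
open import Data.List.Properties
  using (length-filter; length-map; length-reverse; length-++; filter-accept; filter-reject; filter-all; filter-++;
         map-id; map-++; map-∘; map-cong; reverse-++; reverse-map; unfold-reverse; ++-identityʳ)
open import Data.List.Relation.Unary.All using (All; []; _∷_)
import Data.List.Relation.Unary.All as All
import Data.List.Relation.Unary.All.Properties as All
open import Data.List.Relation.Unary.Linked using (Linked; []; [-]; _∷_)
import Data.List.Relation.Unary.Linked as Linked
import Data.List.Relation.Unary.Linked.Properties as Linked
open import Data.Product using (_,_)
open import Data.Sum using (inj₁; inj₂)
open import Relation.Nullary using (¬_; Dec; yes; no)
open import Relation.Binary.PropositionalEquality hiding ([_])

C-absorption : ∀ n k → suc k ℕ.* (suc n C suc k) ≡ suc n ℕ.* (n C k)
C-absorption zero    zero    = refl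
C-absorption zero    (suc k) = *-zeroʳ (2 ℕ.+ k)
C-absorption (suc n) zero    = trans (+-identityʳ _) (trans (nC1≡n (2 ℕ.+ n)) (sym (*-identityʳ (2 ℕ.+ n))))
C-absorption (suc n) (suc k) = begin
  (2 ℕ.+ k) ℕ.* ((2 ℕ.+ n) C (2 ℕ.+ k))
    ≡⟨ cong ((2 ℕ.+ k) ℕ.*_) (nCk+nC[k+1]≡[n+1]C[k+1] (suc n) (suc k)) ⟨
  (2 ℕ.+ k) ℕ.* (a ℕ.+ b)
    ≡⟨ split k a b ⟩
  (1 ℕ.+ k) ℕ.* a ℕ.+ a ℕ.+ (2 ℕ.+ k) ℕ.* b
    ≡⟨ cong₂ (λ u v → u ℕ.+ a ℕ.+ v) (C-absorption n k) (C-absorption n (suc k)) ⟩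
  (1 ℕ.+ n) ℕ.* (n C k) ℕ.+ a ℕ.+ (1 ℕ.+ n) ℕ.* (n C suc k)
    ≡⟨ merge n a (n C k) (n C suc k) ⟩
  (1 ℕ.+ n) ℕ.* (n C k ℕ.+ n C suc k) ℕ.+ a
    ≡⟨ cong (λ u → (1 ℕ.+ n) ℕ.* u ℕ.+ a) (nCk+nC[k+1]≡[n+1]C[k+1] n k) ⟩
  (1 ℕ.+ n) ℕ.* a ℕ.+ a
    ≡⟨ +-comm ((1 ℕ.+ n) ℕ.* a) a ⟩
  (2 ℕ.+ n) ℕ.* a ∎
  where
  open ≡-Reasoning
  a b : ℕ
  a = suc n C suc k
  b = suc n C (2 ℕ.+ k)
  split : ∀ k a b → (2 ℕ.+ k) ℕ.* (a ℕ.+ b) ≡ (1 ℕ.+ k) ℕ.* a ℕ.+ a ℕ.+ (2 ℕ.+ k) ℕ.* b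
  split = ℕ-Solver.solve-∀
  merge : ∀ n a c d → (1 ℕ.+ n) ℕ.* c ℕ.+ a ℕ.+ (1 ℕ.+ n) ℕ.* d ≡ (1 ℕ.+ n) ℕ.* (c ℕ.+ d) ℕ.+ a
  merge = ℕ-Solver.solve-∀

-- k C(m+1,k) = (m+1) (C(m+1,k) − C(m,k)), with the subtraction moved across.
C-absorption′ : ∀ m k → suc m ℕ.* (m C k) ℕ.+ k ℕ.* (suc m C k) ≡ suc m ℕ.* (suc m C k)
C-absorption′ m zero    = +-identityʳ _
C-absorption′ m (suc k) = begin
  suc m ℕ.* (m C suc k) ℕ.+ suc k ℕ.* (suc m C suc k) ≡⟨ cong (suc m ℕ.* (m C suc k) ℕ.+_) (C-absorption m k) ⟩
  suc m ℕ.* (m C suc k) ℕ.+ suc m ℕ.* (m C k)         ≡⟨ +-comm (suc m ℕ.* (m C suc k)) _ ⟩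
  suc m ℕ.* (m C k) ℕ.+ suc m ℕ.* (m C suc k)         ≡⟨ *-distribˡ-+ (suc m) (m C k) _ ⟨
  suc m ℕ.* (m C k ℕ.+ m C suc k)                     ≡⟨ cong (suc m ℕ.*_) (nCk+nC[k+1]≡[n+1]C[k+1] m k) ⟩
  suc m ℕ.* (suc m C suc k)                           ∎
  where open ≡-Reasoning

oddBinomial : ℕ → ℕ → ℕ
oddBinomial x k = (x C k) ℕ.* oddFact k

oddBinomial-pascal : ∀ x k →
  oddBinomial (suc x) (suc k) ≡ oddBinomial x (suc k) ℕ.+ (2 ℕ.* k ℕ.+ 1) ℕ.* oddBinomial x k
oddBinomial-pascal x k = begin
  (suc x C suc k) ℕ.* (t ℕ.* oddFact k)                ≡⟨ cong (ℕ._* (t ℕ.* oddFact k)) (nCk+nC[k+1]≡[n+1]C[k+1] x k) ⟨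
  (x C k ℕ.+ x C suc k) ℕ.* (t ℕ.* oddFact k)          ≡⟨ expand (x C k) (x C suc k) t (oddFact k) ⟩
  (x C suc k) ℕ.* (t ℕ.* oddFact k) ℕ.+ t ℕ.* ((x C k) ℕ.* oddFact k) ∎
  where
  open ≡-Reasoning
  t : ℕ
  t = 2 ℕ.* k ℕ.+ 1
  expand : ∀ c d t o → (c ℕ.+ d) ℕ.* (t ℕ.* o) ≡ d ℕ.* (t ℕ.* o) ℕ.+ t ℕ.* (c ℕ.* o)
  expand = ℕ-Solver.solve-∀

oddBinomial-absorption : ∀ m k →
  (2 ℕ.* k ℕ.+ 1) ℕ.* oddBinomial (suc m) k ℕ.+ 2 ℕ.* suc m ℕ.* oddBinomial m k
    ≡ (2 ℕ.* suc m ℕ.+ 1) ℕ.* oddBinomial (suc m) k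
oddBinomial-absorption m k = begin
  (2 ℕ.* k ℕ.+ 1) ℕ.* (c ℕ.* o) ℕ.+ 2 ℕ.* suc m ℕ.* (c′ ℕ.* o)
    ≡⟨ regroup k (suc m) c c′ o ⟩
  c ℕ.* o ℕ.+ 2 ℕ.* (suc m ℕ.* c′ ℕ.+ k ℕ.* c) ℕ.* o
    ≡⟨ cong (λ u → c ℕ.* o ℕ.+ 2 ℕ.* u ℕ.* o) (C-absorption′ m k) ⟩
  c ℕ.* o ℕ.+ 2 ℕ.* (suc m ℕ.* c) ℕ.* o
    ≡⟨ collect (suc m) c o ⟩
  (2 ℕ.* suc m ℕ.+ 1) ℕ.* (c ℕ.* o) ∎
  where
  open ≡-Reasoning
  c c′ o : ℕ
  c = suc m C k
  c′ = m C k
  o = oddFact k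
  regroup : ∀ k n c c′ o →
    (2 ℕ.* k ℕ.+ 1) ℕ.* (c ℕ.* o) ℕ.+ 2 ℕ.* n ℕ.* (c′ ℕ.* o)
      ≡ c ℕ.* o ℕ.+ 2 ℕ.* (n ℕ.* c′ ℕ.+ k ℕ.* c) ℕ.* o
  regroup = ℕ-Solver.solve-∀
  collect : ∀ n c o → c ℕ.* o ℕ.+ 2 ℕ.* (n ℕ.* c) ℕ.* o ≡ (2 ℕ.* n ℕ.+ 1) ℕ.* (c ℕ.* o)
  collect = ℕ-Solver.solve-∀

oddBinomial[x,1+x]≡0 : ∀ x → oddBinomial x (suc x) ≡ 0
oddBinomial[x,1+x]≡0 x = cong (ℕ._* oddFact (suc x)) (k>n⇒nCk≡0 (n<1+n x))

pos-odd : ∀ k → + (2 ℕ.* k ℕ.+ 1) ≡ + 2 * + k + + 1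
pos-odd k = trans (pos-+ (2 ℕ.* k) 1) (cong (_+ + 1) (pos-* 2 k))

pos-∸ : ∀ {m n} → n ≤ m → + (m ∸ n) ≡ + m - + n
pos-∸ {m} {n} n≤m = trans (sym (⊖-≥ n≤m)) (sym (m-n≡m⊖n m n))

pos-oddBinomial-pascal : ∀ x k →
  + oddBinomial (suc x) (suc k) ≡ + oddBinomial x (suc k) + (+ 2 * + k + + 1) * + oddBinomial x k
pos-oddBinomial-pascal x k = begin
  + oddBinomial (suc x) (suc k)
    ≡⟨ cong +_ (oddBinomial-pascal x k) ⟩
  + (oddBinomial x (suc k) ℕ.+ (2 ℕ.* k ℕ.+ 1) ℕ.* oddBinomial x k)
    ≡⟨ pos-+ (oddBinomial x (suc k)) _ ⟩
  + oddBinomial x (suc k) + + ((2 ℕ.* k ℕ.+ 1) ℕ.* oddBinomial x k)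
    ≡⟨ cong (_+_ (+ oddBinomial x (suc k))) (trans (pos-* (2 ℕ.* k ℕ.+ 1) _) (cong (_* + oddBinomial x k) (pos-odd k))) ⟩
  + oddBinomial x (suc k) + (+ 2 * + k + + 1) * + oddBinomial x k ∎
  where open ≡-Reasoning

pos-oddBinomial-absorption : ∀ m k →
  (+ 2 * + k + + 1) * + oddBinomial (suc m) k + + 2 * + suc m * + oddBinomial m k
    ≡ (+ 2 * + suc m + + 1) * + oddBinomial (suc m) k
pos-oddBinomial-absorption m k = begin
  (+ 2 * + k + + 1) * w + + 2 * + suc m * w′
    ≡⟨ cong₂ (λ a b → a * w + b * w′) (pos-odd k) (pos-* 2 (suc m)) ⟨
  + (2 ℕ.* k ℕ.+ 1) * w + + (2 ℕ.* suc m) * w′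
    ≡⟨ cong₂ _+_ (pos-* (2 ℕ.* k ℕ.+ 1) _) (pos-* (2 ℕ.* suc m) _) ⟨
  + ((2 ℕ.* k ℕ.+ 1) ℕ.* oddBinomial (suc m) k) + + (2 ℕ.* suc m ℕ.* oddBinomial m k)
    ≡⟨ pos-+ ((2 ℕ.* k ℕ.+ 1) ℕ.* oddBinomial (suc m) k) _ ⟨
  + ((2 ℕ.* k ℕ.+ 1) ℕ.* oddBinomial (suc m) k ℕ.+ 2 ℕ.* suc m ℕ.* oddBinomial m k)
    ≡⟨ cong +_ (oddBinomial-absorption m k) ⟩
  + ((2 ℕ.* suc m ℕ.+ 1) ℕ.* oddBinomial (suc m) k)
    ≡⟨ trans (pos-* (2 ℕ.* suc m ℕ.+ 1) _) (cong (_* w) (pos-odd (suc m))) ⟩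
  (+ 2 * + suc m + + 1) * w ∎
  where
  open ≡-Reasoning
  w w′ : ℤ
  w = + oddBinomial (suc m) k
  w′ = + oddBinomial m k

∑-linear : ∀ {n} (α β : ℤ) (a b : Fin n → ℤ) → ∑ (λ k → α * a k - β * b k) ≡ α * ∑ a - β * ∑ b
∑-linear α β a b = begin
  ∑ (λ k → α * a k - β * b k)                 ≡⟨ sum-cong-≗ (λ k → cong (_+_ (α * a k)) (neg-distribˡ-* β (b k))) ⟩
  ∑ (λ k → α * a k + - β * b k)               ≡⟨ ∑-distrib-+ (λ k → α * a k) (λ k → - β * b k) ⟩
  ∑ (λ k → α * a k) + ∑ (λ k → - β * b k)     ≡⟨ cong₂ _+_ (*-distribˡ-sum α a) (*-distribˡ-sum (- β) b) ⟨
  α * ∑ a + - β * ∑ b                         ≡⟨ cong (_+_ (α * ∑ a)) (neg-distribˡ-* β (∑ b)) ⟨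
  α * ∑ a - β * ∑ b                           ∎
  where open ≡-Reasoning

oddBinomialSum : ℕ → (ℕ → ℤ) → ℤ
oddBinomialSum x G = ∑[ k ≤ x ] (+ oddBinomial x (toℕ k) * G (toℕ k))

oddBinomialSum-cong : ∀ x {G H : ℕ → ℤ} → (∀ k → k ≤ x → G k ≡ H k) → oddBinomialSum x G ≡ oddBinomialSum x H
oddBinomialSum-cong x e = sum-cong-≗ {suc x} λ k → cong (+ oddBinomial x (toℕ k) *_) (e (toℕ k) (toℕ≤pred[n] k))

oddBinomialSum-linear : ∀ x (α β : ℤ) G H →
  oddBinomialSum x (λ k → α * G k - β * H k) ≡ α * oddBinomialSum x G - β * oddBinomialSum x H
oddBinomialSum-linear x α β G H =
  trans (sum-cong-≗ {suc x} λ k → distribute (+ oddBinomial x (toℕ k)) α β (G (toℕ k)) (H (toℕ k)))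
        (∑-linear α β (weighted G) (weighted H))
  where
  weighted : (ℕ → ℤ) → Fin (suc x) → ℤ
  weighted F k = + oddBinomial x (toℕ k) * F (toℕ k)
  distribute : ∀ w α β g h → w * (α * g - β * h) ≡ α * (w * g) - β * (w * h)
  distribute = solve-∀

oddBinomialSum-sub : ∀ x G H → oddBinomialSum x (λ k → G k - H k) ≡ oddBinomialSum x G - oddBinomialSum x H
oddBinomialSum-sub x G H = begin
  oddBinomialSum x (λ k → G k - H k)                   ≡⟨ oddBinomialSum-cong x (λ k _ → unit (G k) (H k)) ⟩
  oddBinomialSum x (λ k → + 1 * G k - + 1 * H k)       ≡⟨ oddBinomialSum-linear x (+ 1) (+ 1) G H ⟩
  + 1 * oddBinomialSum x G - + 1 * oddBinomialSum x H  ≡⟨ unit (oddBinomialSum x G) (oddBinomialSum x H) ⟨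
  oddBinomialSum x G - oddBinomialSum x H              ∎
  where
  open ≡-Reasoning
  unit : ∀ a b → a - b ≡ + 1 * a - + 1 * b
  unit = solve-∀

oddBinomialSum-extend : ∀ x G → ∑[ k ≤ suc x ] (+ oddBinomial x (toℕ k) * G (toℕ k)) ≡ oddBinomialSum x G
oddBinomialSum-extend x G = begin
  ∑[ k ≤ suc x ] t k
    ≡⟨ sum-init-last t ⟩
  ∑[ k ≤ x ] t (inject₁ k) + t (fromℕ (suc x))
    ≡⟨ cong₂ _+_ (sum-cong-≗ {suc x} λ k → cong u (toℕ-inject₁ k)) last-vanishes ⟩
  oddBinomialSum x G + + 0
    ≡⟨ +ℤ-identityʳ _ ⟩
  oddBinomialSum x G ∎
  where
  open ≡-Reasoning
  u : ℕ → ℤ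
  u k = + oddBinomial x k * G k
  t : Fin (suc (suc x)) → ℤ
  t k = u (toℕ k)
  last-vanishes : t (fromℕ (suc x)) ≡ + 0
  last-vanishes = trans (cong u (toℕ-fromℕ (suc x))) (cong (λ w → + w * G (suc x)) (oddBinomial[x,1+x]≡0 x))

oddBinomialSum-pascal : ∀ x G →
  oddBinomialSum (suc x) G ≡ oddBinomialSum x (λ k → G k + (+ 2 * + k + + 1) * G (suc k))
oddBinomialSum-pascal x G = begin
  w 0 * G 0 + ∑[ k ≤ x ] (+ oddBinomial (suc x) (suc (toℕ k)) * G (suc (toℕ k)))
    ≡⟨ cong (_+_ (w 0 * G 0)) (sum-cong-≗ {suc x} λ k → pascal (toℕ k)) ⟩
  w 0 * G 0 + ∑[ k ≤ x ] (a (toℕ k) + b (toℕ k))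
    ≡⟨ cong (_+_ (w 0 * G 0)) (∑-distrib-+ {suc x} (λ k → a (toℕ k)) (λ k → b (toℕ k))) ⟩
  w 0 * G 0 + (∑[ k ≤ x ] a (toℕ k) + ∑[ k ≤ x ] b (toℕ k))
    ≡⟨ +-assoc (w 0 * G 0) _ _ ⟨
  ∑[ k ≤ suc x ] (w (toℕ k) * G (toℕ k)) + ∑[ k ≤ x ] b (toℕ k)
    ≡⟨ cong (_+ ∑[ k ≤ x ] b (toℕ k)) (oddBinomialSum-extend x G) ⟩
  oddBinomialSum x G + ∑[ k ≤ x ] b (toℕ k)
    ≡⟨ ∑-distrib-+ {suc x} (λ k → w (toℕ k) * G (toℕ k)) (λ k → b (toℕ k)) ⟨
  ∑[ k ≤ x ] (w (toℕ k) * G (toℕ k) + b (toℕ k))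
    ≡⟨ sum-cong-≗ {suc x} (λ k → collect (w (toℕ k)) (G (toℕ k)) (+ 2 * + toℕ k + + 1) (G (suc (toℕ k)))) ⟩
  oddBinomialSum x (λ k → G k + (+ 2 * + k + + 1) * G (suc k)) ∎
  where
  open ≡-Reasoning
  w : ℕ → ℤ
  w k = + oddBinomial x k
  a b : ℕ → ℤ
  a k = w (suc k) * G (suc k)
  b k = (+ 2 * + k + + 1) * (w k * G (suc k))
  distribute : ∀ u t v g → (u + t * v) * g ≡ u * g + t * (v * g)
  distribute = solve-∀
  pascal : ∀ k → + oddBinomial (suc x) (suc k) * G (suc k) ≡ a k + b k
  pascal k = trans (cong (_* G (suc k)) (pos-oddBinomial-pascal x k)) (distribute (w (suc k)) (+ 2 * + k + + 1) (w k) (G (suc k)))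
  collect : ∀ w g t h → w * g + t * (w * h) ≡ w * (g + t * h)
  collect = solve-∀

oddBinomialSum-difference : ∀ x G →
  oddBinomialSum (suc x) G - oddBinomialSum x G ≡ oddBinomialSum x (λ k → (+ 2 * + k + + 1) * G (suc k))
oddBinomialSum-difference x G = begin
  oddBinomialSum (suc x) G - oddBinomialSum x G ≡⟨ cong (_- oddBinomialSum x G) (oddBinomialSum-pascal x G) ⟩
  oddBinomialSum x ΔG - oddBinomialSum x G      ≡⟨ oddBinomialSum-sub x ΔG G ⟨
  oddBinomialSum x (λ k → ΔG k - G k)           ≡⟨ oddBinomialSum-cong x (λ k _ → cancel (G k) (+ 2 * + k + + 1) (G (suc k))) ⟩
  oddBinomialSum x (λ k → (+ 2 * + k + + 1) * G (suc k)) ∎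
  where
  open ≡-Reasoning
  ΔG : ℕ → ℤ
  ΔG k = G k + (+ 2 * + k + + 1) * G (suc k)
  cancel : ∀ g t h → (g + t * h) - g ≡ t * h
  cancel = solve-∀

-- At m = 0 the truncated m ∸ 1 is harmless: its coefficient is 0.
oddBinomialSum-odd : ∀ m H →
  oddBinomialSum m (λ k → (+ 2 * + k + + 1) * H k)
    ≡ (+ 2 * + m + + 1) * oddBinomialSum m H - + 2 * + m * oddBinomialSum (m ∸ 1) H
oddBinomialSum-odd zero    H = single (H 0)
  where
  single : ∀ h → + 1 * ((+ 2 * + 0 + + 1) * h) + + 0 ≡ (+ 2 * + 0 + + 1) * (+ 1 * h + + 0) - + 2 * + 0 * (+ 1 * h + + 0)
  single = solve-∀
oddBinomialSum-odd (suc m) H = begin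
  oddBinomialSum (suc m) (λ k → (+ 2 * + k + + 1) * H k)
    ≡⟨ sum-cong-≗ {2 ℕ.+ m} (λ k → weights (toℕ k)) ⟩
  ∑[ k ≤ suc m ] (α * (w (toℕ k) * H (toℕ k)) - β * (w′ (toℕ k) * H (toℕ k)))
    ≡⟨ ∑-linear {2 ℕ.+ m} α β (λ k → w (toℕ k) * H (toℕ k)) (λ k → w′ (toℕ k) * H (toℕ k)) ⟩
  α * oddBinomialSum (suc m) H - β * ∑[ k ≤ suc m ] (w′ (toℕ k) * H (toℕ k))
    ≡⟨ cong (λ s → α * oddBinomialSum (suc m) H - β * s) (oddBinomialSum-extend m H) ⟩
  α * oddBinomialSum (suc m) H - β * oddBinomialSum m H ∎
  where
  open ≡-Reasoning
  α β : ℤ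
  α = + 2 * + suc m + + 1
  β = + 2 * + suc m
  w w′ : ℕ → ℤ
  w k = + oddBinomial (suc m) k
  w′ k = + oddBinomial m k
  unsubtract : ∀ t v u h → v * (t * h) ≡ ((t * v + u) - u) * h
  unsubtract = solve-∀
  distribute : ∀ a b c d h → (a * c - b * d) * h ≡ a * (c * h) - b * (d * h)
  distribute = solve-∀
  weights : ∀ k → w k * ((+ 2 * + k + + 1) * H k) ≡ α * (w k * H k) - β * (w′ k * H k)
  weights k = begin
    w k * ((+ 2 * + k + + 1) * H k)
      ≡⟨ unsubtract (+ 2 * + k + + 1) (w k) (β * w′ k) (H k) ⟩
    (((+ 2 * + k + + 1) * w k + β * w′ k) - β * w′ k) * H k
      ≡⟨ cong (λ z → (z - β * w′ k) * H k) (pos-oddBinomial-absorption m k) ⟩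
    (α * w k - β * w′ k) * H k
      ≡⟨ distribute α β (w k) (w′ k) (H k) ⟩
    α * (w k * H k) - β * (w′ k * H k) ∎

-- The decision procedure of dropZeros, so that the filter lemmas apply to it.
positive? : ∀ x → Dec (1 ≤ x)
positive? x = 1 ≤? x

minusHat-accept : ∀ k y l → 1 ≤ y ∸ k → minusHat k (y ∷ l) ≡ y ∸ k ∷ minusHat k l
minusHat-accept k y l = filter-accept positive?

minusHat-reject : ∀ k y l → ¬ 1 ≤ y ∸ k → minusHat k (y ∷ l) ≡ minusHat k l
minusHat-reject k y l = filter-reject positive?

minusHat-∷-cong : ∀ k y {l l′} → minusHat k l ≡ minusHat k l′ → minusHat k (y ∷ l) ≡ minusHat k (y ∷ l′)
minusHat-∷-cong k y {l} {l′} e with positive? (y ∸ k)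
... | yes p = trans (minusHat-accept k y l p) (trans (cong (y ∸ k ∷_) e) (sym (minusHat-accept k y l′ p)))
... | no ¬p = trans (minusHat-reject k y l ¬p) (trans e (sym (minusHat-reject k y l′ ¬p)))

minusHat-dropZeros : ∀ k l → minusHat k (dropZeros l) ≡ minusHat k l
minusHat-dropZeros k [] = refl
minusHat-dropZeros k (zero ∷ l) rewrite 0∸n≡0 k = minusHat-dropZeros k l
minusHat-dropZeros k (suc y ∷ l) = minusHat-∷-cong k (suc y) (minusHat-dropZeros k l)

minusHat-minusHat : ∀ a b l → minusHat a (minusHat b l) ≡ minusHat (b ℕ.+ a) l
minusHat-minusHat a b l = trans (minusHat-dropZeros a (map (_∸ b) l))
  (cong dropZeros (trans (sym (map-∘ l)) (map-cong (λ y → ∸-+-assoc y b a) l)))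

minusHat-all-above : ∀ k l → All (k <_) l → minusHat k l ≡ map (_∸ k) l
minusHat-all-above k l k<l = filter-all positive? (All.map⁺ (All.map m<n⇒0<n∸m k<l))

minusHat-suc : ∀ j l → minusHat 1 (minusHat j l) ≡ minusHat (suc j) l
minusHat-suc j l = trans (minusHat-minusHat 1 j l) (cong (λ n → minusHat n l) (+-comm j 1))

minusHat-zero : ∀ l → All (0 <_) l → minusHat 0 l ≡ l
minusHat-zero l 0<l = trans (minusHat-all-above 0 l 0<l) (map-id l)

minusHat-∷ʳ : ∀ k l x → minusHat k (l ∷ʳ x) ≡ minusHat k l ++ minusHat k [ x ]
minusHat-∷ʳ k l x = trans (cong dropZeros (map-++ (_∸ k) l [ x ])) (filter-++ positive? (map (_∸ k) l) _)

minusHat-positive : ∀ k l → All (0 <_) (minusHat k l)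
minusHat-positive k l = All.all-filter positive? (map (_∸ k) l)

length-minusHat : ∀ k l → length (minusHat k l) ≤ length l
length-minusHat k l = ≤-trans (length-filter positive? (map (_∸ k) l)) (≤-reflexive (length-map (_∸ k) l))

length-minusHat-∷ : ∀ k y l → length (minusHat k l) ≤ length (minusHat k (y ∷ l))
length-minusHat-∷ k y l with positive? (y ∸ k)
... | yes p = subst (λ l′ → length (minusHat k l) ≤ length l′) (sym (minusHat-accept k y l p)) (n≤1+n _)
... | no ¬p = subst (λ l′ → length (minusHat k l) ≤ length l′) (sym (minusHat-reject k y l ¬p)) ≤-refl

minusHat-nonempty : ∀ l j → 2 ≤ part l j → 0 < length (minusHat 1 l)
minusHat-nonempty (suc zero ∷ l)    (suc zero) (s≤s ())
minusHat-nonempty (suc (suc y) ∷ l) (suc zero) _ =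
  subst (λ l′ → 0 < length l′) (sym (minusHat-accept 1 (2 ℕ.+ y) l (s≤s z≤n))) (s≤s z≤n)
minusHat-nonempty (y ∷ l) (suc (suc j)) 2≤l = ≤-trans (minusHat-nonempty l (suc j) 2≤l) (length-minusHat-∷ 1 y l)

dropZeros-reverse : ∀ l → dropZeros (reverse l) ≡ reverse (dropZeros l)
dropZeros-reverse [] = refl
dropZeros-reverse (y ∷ l) = begin
  dropZeros (reverse (y ∷ l))              ≡⟨ cong dropZeros (unfold-reverse y l) ⟩
  dropZeros (reverse l ++ [ y ])           ≡⟨ filter-++ positive? (reverse l) [ y ] ⟩
  dropZeros (reverse l) ++ dropZeros [ y ] ≡⟨ cong₂ _++_ (dropZeros-reverse l) (sym (reverse-dropZeros-singleton y)) ⟩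
  reverse (dropZeros l) ++ reverse (dropZeros [ y ]) ≡⟨ reverse-++ (dropZeros [ y ]) (dropZeros l) ⟨
  reverse (dropZeros [ y ] ++ dropZeros l) ≡⟨ cong reverse (filter-++ positive? [ y ] l) ⟨
  reverse (dropZeros (y ∷ l))              ∎
  where
  open ≡-Reasoning
  reverse-dropZeros-singleton : ∀ y → reverse (dropZeros [ y ]) ≡ dropZeros [ y ]
  reverse-dropZeros-singleton zero    = refl
  reverse-dropZeros-singleton (suc y) = refl

reverse-minusHat : ∀ k l → reverse (minusHat k l) ≡ minusHat k (reverse l)
reverse-minusHat k l = trans (sym (dropZeros-reverse (map (_∸ k) l))) (cong dropZeros (sym (reverse-map (_∸ k) l)))

length-∷ʳ : ∀ (η : List ℕ) x → length (η ∷ʳ x) ≡ suc (length η)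
length-∷ʳ η x = trans (length-++ η) (+-comm (length η) 1)

part-∷ʳ : ∀ η x i → i ≤ length η → part (η ∷ʳ x) i ≡ part η i
part-∷ʳ []      x zero          _         = refl
part-∷ʳ (y ∷ η) x zero          _         = refl
part-∷ʳ (y ∷ η) x (suc zero)    _         = refl
part-∷ʳ (y ∷ η) x (suc (suc j)) (s≤s i≤η) = part-∷ʳ η x (suc j) i≤η

part-last : ∀ η x → part (η ∷ʳ x) (suc (length η)) ≡ x
part-last []      x = refl
part-last (y ∷ η) x = part-last η x

part-∷ʳ-last : ∀ η x → part (η ∷ʳ x) (length (η ∷ʳ x)) ≡ x
part-∷ʳ-last η x = trans (cong (part (η ∷ʳ x)) (length-∷ʳ η x)) (part-last η x)

part-map : ∀ k η i → part (map (_∸ k) η) i ≡ part η i ∸ k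
part-map k []      i             = sym (0∸n≡0 k)
part-map k (y ∷ η) zero          = sym (0∸n≡0 k)
part-map k (y ∷ η) (suc zero)    = refl
part-map k (y ∷ η) (suc (suc j)) = part-map k η (suc j)

All-part : ∀ {P : ℕ → Set} η i → All P η → 1 ≤ i → i ≤ length η → P (part η i)
All-part (y ∷ η) (suc zero)    (py ∷ _)  _ _         = py
All-part (y ∷ η) (suc (suc j)) (_ ∷ pη) _ (s≤s i≤η) = All-part η (suc j) pη (s≤s z≤n) i≤η

up-∷ʳ : ∀ η x i → i ≤ length η → up (η ∷ʳ x) i ≡ up η i ∷ʳ x
up-∷ʳ []      x zero          _         = refl
up-∷ʳ (y ∷ η) x zero          _         = refl
up-∷ʳ (y ∷ η) x (suc zero)    _         = refl
up-∷ʳ (y ∷ η) x (suc (suc j)) (s≤s i≤η) = cong (y ∷_) (up-∷ʳ η x (suc j) i≤η)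

up-last : ∀ η x → up (η ∷ʳ x) (suc (length η)) ≡ η ∷ʳ suc x
up-last []          x = refl
up-last (y ∷ [])    x = refl
up-last (y ∷ z ∷ η) x = cong (y ∷_) (up-last (z ∷ η) x)

up-map : ∀ k η i → All (k ≤_) η → map (_∸ k) (up η i) ≡ up (map (_∸ k) η) i
up-map k []      i             _            = refl
up-map k (y ∷ η) zero          _            = refl
up-map k (y ∷ η) (suc zero)    (k≤y ∷ _)    = cong (_∷ map (_∸ k) η) (+-∸-assoc 1 k≤y)
up-map k (y ∷ η) (suc (suc j)) (_ ∷ k≤η)    = cong (y ∸ k ∷_) (up-map k η (suc j) k≤η)

length-up : ∀ η i → length (up η i) ≡ length η
length-up []      i             = refl
length-up (y ∷ η) zero          = refl
length-up (y ∷ η) (suc zero)    = refl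
length-up (y ∷ η) (suc (suc j)) = cong suc (length-up η (suc j))

part-up : ∀ η i → 1 ≤ i → i ≤ length η → part (up η i) i ≡ suc (part η i)
part-up (y ∷ η) (suc zero)    _ _         = refl
part-up (y ∷ η) (suc (suc j)) _ (s≤s i≤η) = part-up η (suc j) (s≤s z≤n) i≤η

All-up : ∀ {P : ℕ → Set} η i → (∀ {y} → P y → P (suc y)) → All P η → All P (up η i)
All-up []      i             _ _          = []
All-up (y ∷ η) zero          _ pη         = pη
All-up (y ∷ η) (suc zero)    s (py ∷ pη)  = s py ∷ pη
All-up (y ∷ η) (suc (suc j)) s (py ∷ pη)  = py ∷ All-up η (suc j) s pη

decLast-∷ʳ : ∀ η x → decLast (η ∷ʳ x) ≡ η ∷ʳ (x ∸ 1)
decLast-∷ʳ []          x = refl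
decLast-∷ʳ (y ∷ [])    x = refl
decLast-∷ʳ (y ∷ z ∷ η) x = cong (y ∷_) (decLast-∷ʳ (z ∷ η) x)

Linked-∷ʳ⁻ : ∀ η x → Linked _≥_ (η ∷ʳ x) → Linked _≥_ η
Linked-∷ʳ⁻ []          x _           = []
Linked-∷ʳ⁻ (y ∷ [])    x _           = [-]
Linked-∷ʳ⁻ (y ∷ z ∷ η) x (y≥z ∷ lnk) = y≥z ∷ Linked-∷ʳ⁻ (z ∷ η) x lnk

Linked-∷ʳ⇒All : ∀ η x → Linked _≥_ (η ∷ʳ x) → All (x ≤_) η
Linked-∷ʳ⇒All []          x _           = []
Linked-∷ʳ⇒All (y ∷ [])    x (y≥x ∷ _)   = y≥x ∷ []
Linked-∷ʳ⇒All (y ∷ z ∷ η) x (y≥z ∷ lnk) with Linked-∷ʳ⇒All (z ∷ η) x lnk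
... | z≥x ∷ η≥x = ≤-trans z≥x y≥z ∷ z≥x ∷ η≥x

sumFrom1-cong : ∀ n {g h : ℕ → ℕ} → (∀ k → g k ≡ h k) → sumFrom1 n g ≡ sumFrom1 n h
sumFrom1-cong zero    e = refl
sumFrom1-cong (suc n) e = cong₂ ℕ._+_ (sumFrom1-cong n e) (e (suc n))

fRev-fuel : ∀ m n l → length l ≤ m → length l ≤ n → fRev m l ≡ fRev n l
fRev-fuel _       _       []            _       _       = refl
fRev-fuel _       _       (x ∷ [])      _       _       = refl
fRev-fuel (suc m) (suc n) (x ∷ y ∷ r) (s≤s l≤m) (s≤s l≤n) =
  cong₂ ℕ._+_ (fRev-fuel m n (y ∷ r) l≤m l≤n) (sumFrom1-cong x λ k →
    cong ((x C k) ℕ.* oddFact k ℕ.*_) (fRev-fuel m n (minusHat k (y ∷ r))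
      (≤-trans (length-minusHat k (y ∷ r)) l≤m) (≤-trans (length-minusHat k (y ∷ r)) l≤n)))

fʳ : List ℕ → ℕ
fʳ l = fRev (length l) l

f-reverse : ∀ l → f l ≡ fʳ (reverse l)
f-reverse l = cong (λ m → fRev m (reverse l)) (sym (length-reverse l))

fʳ-∷ : ∀ x l → 0 < length l →
  fʳ (x ∷ l) ≡ fʳ l ℕ.+ sumFrom1 x (λ k → (x C k) ℕ.* oddFact k ℕ.* fʳ (minusHat k l))
fʳ-∷ x l@(_ ∷ _) _ = cong (fʳ l ℕ.+_) (sumFrom1-cong x λ k →
  cong ((x C k) ℕ.* oddFact k ℕ.*_) (fRev-fuel _ _ (minusHat k l) (length-minusHat k l) ≤-refl))

f-∷ʳ : ∀ η x → 0 < length η →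
  f (η ∷ʳ x) ≡ f η ℕ.+ sumFrom1 x (λ k → (x C k) ℕ.* oddFact k ℕ.* f (minusHat k η))
f-∷ʳ η x 0<η = begin
  f (η ∷ʳ x)                ≡⟨ f-reverse (η ∷ʳ x) ⟩
  fʳ (reverse (η ++ [ x ])) ≡⟨ cong fʳ (reverse-++ η [ x ]) ⟩
  fʳ (x ∷ reverse η)        ≡⟨ fʳ-∷ x (reverse η) (subst (0 <_) (sym (length-reverse η)) 0<η) ⟩
  fʳ (reverse η) ℕ.+ sumFrom1 x (λ k → (x C k) ℕ.* oddFact k ℕ.* fʳ (minusHat k (reverse η)))
    ≡⟨ cong₂ ℕ._+_ (sym (f-reverse η)) (sumFrom1-cong x λ k → cong ((x C k) ℕ.* oddFact k ℕ.*_)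
         (trans (cong fʳ (sym (reverse-minusHat k η))) (sym (f-reverse (minusHat k η))))) ⟩
  f η ℕ.+ sumFrom1 x (λ k → (x C k) ℕ.* oddFact k ℕ.* f (minusHat k η)) ∎
  where open ≡-Reasoning

sumFrom1-∑ : ∀ n h → + sumFrom1 n h ≡ ∑ (λ (k : Fin n) → + h (suc (toℕ k)))
sumFrom1-∑ zero    h = refl
sumFrom1-∑ (suc n) h = begin
  + (sumFrom1 n h ℕ.+ h (suc n))                         ≡⟨ pos-+ (sumFrom1 n h) (h (suc n)) ⟩
  + sumFrom1 n h + + h (suc n)
    ≡⟨ cong₂ _+_ (sumFrom1-∑ n h) (cong (λ k → + h (suc k)) (sym (toℕ-fromℕ n))) ⟩
  ∑ (λ (k : Fin n) → + h (suc (toℕ k))) + t (fromℕ n)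
    ≡⟨ cong (_+ t (fromℕ n)) (sum-cong-≗ {n} λ k → cong (λ j → + h (suc j)) (toℕ-inject₁ k)) ⟨
  ∑ (λ (k : Fin n) → t (inject₁ k)) + t (fromℕ n)
    ≡⟨ sum-init-last t ⟨
  ∑ t                                                    ∎
  where
  open ≡-Reasoning
  t : Fin (suc n) → ℤ
  t k = + h (suc (toℕ k))

f-∷ʳ-oddBinomialSum : ∀ η x → 0 < length η → All (0 <_) η →
  + f (η ∷ʳ x) ≡ oddBinomialSum x (λ k → + f (minusHat k η))
f-∷ʳ-oddBinomialSum η x 0<η 0<η⋆ = begin
  + f (η ∷ʳ x)                                       ≡⟨ cong +_ (f-∷ʳ η x 0<η) ⟩
  + (f η ℕ.+ sumFrom1 x h)                           ≡⟨ pos-+ (f η) (sumFrom1 x h) ⟩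
  + f η + + sumFrom1 x h                             ≡⟨ cong₂ _+_ head (sumFrom1-∑ x h) ⟩
  + 1 * G 0 + ∑ (λ (k : Fin x) → + h (suc (toℕ k)))
    ≡⟨ cong (_+_ (+ 1 * G 0)) (sum-cong-≗ {x} λ k → pos-* (oddBinomial x (suc (toℕ k))) _) ⟩
  oddBinomialSum x G                                 ∎
  where
  open ≡-Reasoning
  G : ℕ → ℤ
  G k = + f (minusHat k η)
  h : ℕ → ℕ
  h k = (x C k) ℕ.* oddFact k ℕ.* f (minusHat k η)
  head : + f η ≡ + 1 * G 0
  head = sym (trans (*-identityˡ (G 0)) (cong (λ l → + f l) (minusHat-zero η 0<η⋆)))

f-∷ʳ-zero : ∀ η → 0 < length η → f (η ∷ʳ 0) ≡ f η
f-∷ʳ-zero η 0<η = trans (f-∷ʳ η 0 0<η) (+-identityʳ (f η))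

f-dropZeros-∷ʳ : ∀ η m → 0 < length η → All (0 <_) η → f (dropZeros (η ∷ʳ m)) ≡ f (η ∷ʳ m)
f-dropZeros-∷ʳ η m 0<η 0<η⋆ =
  trans (cong f (trans (filter-++ positive? η [ m ]) (cong (_++ dropZeros [ m ]) (filter-all positive? 0<η⋆))))
        (lastPart m)
  where
  lastPart : ∀ m → f (η ++ dropZeros [ m ]) ≡ f (η ∷ʳ m)
  lastPart zero    = trans (cong f (++-identityʳ η)) (sym (f-∷ʳ-zero η 0<η))
  lastPart (suc m) = refl

f-minusHat-∷ʳ : ∀ η m → 0 < length (minusHat 1 η) →
  + f (minusHat 1 (η ∷ʳ suc m)) ≡ oddBinomialSum m (λ k → + f (minusHat (suc k) η))
f-minusHat-∷ʳ η m 0<η₁ = begin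
  + f (minusHat 1 (η ∷ʳ suc m))  ≡⟨ cong (λ l → + f l) (minusHat-∷ʳ 1 η (suc m)) ⟩
  + f (η₁ ++ minusHat 1 [ suc m ]) ≡⟨ cong +_ (lastPart m) ⟩
  + f (η₁ ∷ʳ m)                  ≡⟨ f-∷ʳ-oddBinomialSum η₁ m 0<η₁ (minusHat-positive 1 η) ⟩
  oddBinomialSum m (λ k → + f (minusHat k η₁))
    ≡⟨ oddBinomialSum-cong m (λ k _ → cong (λ l → + f l) (minusHat-minusHat k 1 η)) ⟩
  oddBinomialSum m (λ k → + f (minusHat (suc k) η)) ∎
  where
  open ≡-Reasoning
  η₁ : List ℕ
  η₁ = minusHat 1 η
  lastPart : ∀ m → f (η₁ ++ minusHat 1 [ suc m ]) ≡ f (η₁ ∷ʳ m)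
  lastPart zero    = trans (cong f (++-identityʳ η₁)) (sym (f-∷ʳ-zero η₁ 0<η₁))
  lastPart (suc m) = refl

f-∷ʳ-suc : ∀ η m → 0 < length η → All (0 <_) η → 0 < length (minusHat 1 η) →
  + f (η ∷ʳ suc m) - + f (η ∷ʳ m)
    ≡ (+ 2 * + m + + 1) * + f (minusHat 1 (η ∷ʳ suc m)) - + 2 * + m * + f (minusHat 1 (η ∷ʳ m))
f-∷ʳ-suc η m 0<η 0<η⋆ 0<η₁ = begin
  + f (η ∷ʳ suc m) - + f (η ∷ʳ m)
    ≡⟨ cong₂ _-_ (f-∷ʳ-oddBinomialSum η (suc m) 0<η 0<η⋆) (f-∷ʳ-oddBinomialSum η m 0<η 0<η⋆) ⟩
  oddBinomialSum (suc m) G - oddBinomialSum m G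
    ≡⟨ oddBinomialSum-difference m G ⟩
  oddBinomialSum m (λ k → (+ 2 * + k + + 1) * G (suc k))
    ≡⟨ oddBinomialSum-odd m (λ k → G (suc k)) ⟩
  (+ 2 * + m + + 1) * oddBinomialSum m (λ k → G (suc k)) - + 2 * + m * oddBinomialSum (m ∸ 1) (λ k → G (suc k))
    ≡⟨ cong₂ (λ a b → (+ 2 * + m + + 1) * a - b) (sym (f-minusHat-∷ʳ η m 0<η₁)) (shorter m) ⟩
  (+ 2 * + m + + 1) * + f (minusHat 1 (η ∷ʳ suc m)) - + 2 * + m * + f (minusHat 1 (η ∷ʳ m)) ∎
  where
  open ≡-Reasoning
  G : ℕ → ℤ
  G k = + f (minusHat k η)
  shorter : ∀ m → + 2 * + m * oddBinomialSum (m ∸ 1) (λ k → G (suc k)) ≡ + 2 * + m * + f (minusHat 1 (η ∷ʳ m))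
  shorter zero    = refl
  shorter (suc m) = cong (_*_ (+ 2 * + suc m)) (sym (f-minusHat-∷ʳ η m 0<η₁))

RaiseEquation : List ℕ → List ℕ → ℤ → Set
RaiseEquation U V A = + f U - + f V ≡ (A + + 1) * + f (minusHat 1 U) - A * + f (minusHat 1 V)

RaiseIdentity : List ℕ → ℕ → Set
RaiseIdentity ν i = RaiseEquation (up ν i) ν (+ 2 * + part ν i + + length ν - + i)

raise-last : ∀ η x → IsPartition (η ∷ʳ x) → 0 < length η →
  part (η ∷ʳ x) (suc (length η)) < part (η ∷ʳ x) (length η) → RaiseIdentity (η ∷ʳ x) (suc (length η))
raise-last η x (_ , 0<ηx) 0<η x<η rewrite up-last η x | part-last η x = begin
  + f (η ∷ʳ suc x) - + f (η ∷ʳ x)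
    ≡⟨ f-∷ʳ-suc η x 0<η 0<η⋆ (minusHat-nonempty η (length η) (≤-trans (s≤s 0<x) x<η′)) ⟩
  (+ 2 * + x + + 1) * F - + 2 * + x * G
    ≡⟨ offset (+ x) (+ suc (length η)) F G ⟩
  ((+ 2 * + x + + suc (length η) - + suc (length η)) + + 1) * F - (+ 2 * + x + + suc (length η) - + suc (length η)) * G
    ≡⟨ cong (λ n → ((+ 2 * + x + + n - + suc (length η)) + + 1) * F - (+ 2 * + x + + n - + suc (length η)) * G)
            (length-∷ʳ η x) ⟨
  ((+ 2 * + x + + length (η ∷ʳ x) - + suc (length η)) + + 1) * F - (+ 2 * + x + + length (η ∷ʳ x) - + suc (length η)) * G ∎
  where
  open ≡-Reasoning
  F G : ℤ
  F = + f (minusHat 1 (η ∷ʳ suc x))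
  G = + f (minusHat 1 (η ∷ʳ x))
  x<η′ : x < part η (length η)
  x<η′ = subst (x <_) (part-∷ʳ η x (length η) ≤-refl) x<η
  0<η⋆ : All (0 <_) η
  0<η⋆ = All.++⁻ˡ η 0<ηx
  0<x : 0 < x
  0<x with All.++⁻ʳ η 0<ηx
  ... | 0<x ∷ [] = 0<x
  offset : ∀ a s F G → (+ 2 * a + + 1) * F - + 2 * a * G ≡ ((+ 2 * a + s - s) + + 1) * F - (+ 2 * a + s - s) * G
  offset = solve-∀

IsPartition-map-∸ : ∀ j η → All (j <_) η → IsPartition η → IsPartition (map (_∸ j) η)
IsPartition-map-∸ j η j<η (lnk , _) =
  Linked.map⁺ (Linked.map (∸-monoˡ-≤ j) lnk) , All.map⁺ (All.map m<n⇒0<n∸m j<η)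

-- The induction hypothesis at η − ĵ, read back in terms of η.
raise-minusHat : ∀ η i j → IsPartition η → 1 ≤ i → i ≤ length η → All (j <_) η →
  part η i < part η (i ∸ 1) →
  (∀ ν → length ν ≡ length η → IsPartition ν → part ν i < part ν (i ∸ 1) → RaiseIdentity ν i) →
  let A = + 2 * (+ part η i - + j) + + length η - + i in
  + f (minusHat j (up η i)) - + f (minusHat j η)
    ≡ (A + + 1) * + f (minusHat (suc j) (up η i)) - A * + f (minusHat (suc j) η)
raise-minusHat η i j ptn 1≤i i≤η j<η ηᵢ<ηᵢ₋₁ ih =
  trans (subst₂ (λ U V → RaiseEquation U V A) up-ηⱼ ηⱼ
           (subst (RaiseEquation (up (map (_∸ j) η) i) (map (_∸ j) η)) Aⱼ raiseⱼ))
        (cong₂ (λ U V → (A + + 1) * + f U - A * + f V) (minusHat-suc j (up η i)) (minusHat-suc j η))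
  where
  j≤η : All (j ≤_) η
  j≤η = All.map <⇒≤ j<η
  j≤ηᵢ : j ≤ part η i
  j≤ηᵢ = All-part η i j≤η 1≤i i≤η
  A : ℤ
  A = + 2 * (+ part η i - + j) + + length η - + i
  raiseⱼ : RaiseIdentity (map (_∸ j) η) i
  raiseⱼ = ih (map (_∸ j) η) (length-map (_∸ j) η) (IsPartition-map-∸ j η j<η ptn)
    (subst₂ _<_ (sym (part-map j η i)) (sym (part-map j η (i ∸ 1))) (∸-monoˡ-< ηᵢ<ηᵢ₋₁ j≤ηᵢ))
  Aⱼ : + 2 * + part (map (_∸ j) η) i + + length (map (_∸ j) η) - + i ≡ A
  Aⱼ = cong₂ (λ p t → + 2 * p + + t - + i) (trans (cong +_ (part-map j η i)) (pos-∸ j≤ηᵢ)) (length-map (_∸ j) η)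
  up-ηⱼ : up (map (_∸ j) η) i ≡ minusHat j (up η i)
  up-ηⱼ = trans (sym (up-map j η i j≤η)) (sym (minusHat-all-above j (up η i) (All-up η i m<n⇒m<1+n j<η)))
  ηⱼ : map (_∸ j) η ≡ minusHat j η
  ηⱼ = sym (minusHat-all-above j η j<η)

-- The identity for η − ĵ has coefficient A − 2j − 1; adding the Pascal weight 2j + 1 restores A.
recombine : ∀ p j t i Pⱼ Qⱼ P′ Q′ →
  Pⱼ - Qⱼ ≡ ((+ 2 * (p - j) + t - i) + + 1) * P′ - (+ 2 * (p - j) + t - i) * Q′ →
  (Pⱼ + (+ 2 * j + + 1) * P′) - (Qⱼ + (+ 2 * j + + 1) * Q′)
    ≡ ((+ 2 * p + (+ 1 + t) - i) + + 1) * P′ - (+ 2 * p + (+ 1 + t) - i) * Q′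
recombine p j t i Pⱼ Qⱼ P′ Q′ e =
  trans (split Pⱼ Qⱼ j P′ Q′) (trans (cong (_+ (+ 2 * j + + 1) * (P′ - Q′)) e) (merge p j t i P′ Q′))
  where
  split : ∀ Pⱼ Qⱼ j P′ Q′ →
    (Pⱼ + (+ 2 * j + + 1) * P′) - (Qⱼ + (+ 2 * j + + 1) * Q′) ≡ (Pⱼ - Qⱼ) + (+ 2 * j + + 1) * (P′ - Q′)
  split = solve-∀
  merge : ∀ p j t i P′ Q′ →
    ((+ 2 * (p - j) + t - i) + + 1) * P′ - (+ 2 * (p - j) + t - i) * Q′ + (+ 2 * j + + 1) * (P′ - Q′)
      ≡ ((+ 2 * p + (+ 1 + t) - i) + + 1) * P′ - (+ 2 * p + (+ 1 + t) - i) * Q′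
  merge = solve-∀

raise-∷ʳ : ∀ η x i → 2 ≤ i → i ≤ length η → IsPartition (η ∷ʳ suc x) →
  part (η ∷ʳ suc x) i < part (η ∷ʳ suc x) (i ∸ 1) →
  (∀ ν → length ν ≡ length η → IsPartition ν → part ν i < part ν (i ∸ 1) → RaiseIdentity ν i) →
  RaiseIdentity (η ∷ʳ suc x) i
raise-∷ʳ η x i 2≤i i≤η (lnk , 0<ηX) ηXᵢ<ηXᵢ₋₁ ih rewrite up-∷ʳ η (suc x) i i≤η = begin
  + f (L ∷ʳ suc x) - + f (η ∷ʳ suc x)
    ≡⟨ cong₂ _-_ (f-∷ʳ-oddBinomialSum L (suc x) 0<L 0<L⋆) (f-∷ʳ-oddBinomialSum η (suc x) 0<η 0<η⋆) ⟩
  oddBinomialSum (suc x) P - oddBinomialSum (suc x) Q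
    ≡⟨ cong₂ _-_ (oddBinomialSum-pascal x P) (oddBinomialSum-pascal x Q) ⟩
  oddBinomialSum x (Δ P) - oddBinomialSum x (Δ Q)
    ≡⟨ oddBinomialSum-sub x (Δ P) (Δ Q) ⟨
  oddBinomialSum x (λ j → Δ P j - Δ Q j)
    ≡⟨ oddBinomialSum-cong x (λ j j≤x → recombine (+ part η i) (+ j) (+ length η) (+ i) (P j) (Q j) (P (suc j)) (Q (suc j))
         (raise-minusHat η i j ptn 1≤i i≤η (j<η j≤x) ηᵢ<ηᵢ₋₁ ih)) ⟩
  oddBinomialSum x (λ j → (A + + 1) * P (suc j) - A * Q (suc j))
    ≡⟨ oddBinomialSum-linear x (A + + 1) A (λ j → P (suc j)) (λ j → Q (suc j)) ⟩
  (A + + 1) * oddBinomialSum x (λ j → P (suc j)) - A * oddBinomialSum x (λ j → Q (suc j))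
    ≡⟨ cong₂ (λ a b → (A + + 1) * a - A * b) (f-minusHat-∷ʳ L x 0<L₁) (f-minusHat-∷ʳ η x 0<η₁) ⟨
  (A + + 1) * + f (minusHat 1 (L ∷ʳ suc x)) - A * + f (minusHat 1 (η ∷ʳ suc x))
    ≡⟨ cong₂ (λ p n → ((+ 2 * + p + + n - + i) + + 1) * + f (minusHat 1 (L ∷ʳ suc x))
                       - (+ 2 * + p + + n - + i) * + f (minusHat 1 (η ∷ʳ suc x)))
             (part-∷ʳ η (suc x) i i≤η) (length-∷ʳ η (suc x)) ⟨
  _ ∎
  where
  open ≡-Reasoning
  L : List ℕ
  L = up η i
  P Q : ℕ → ℤ
  P k = + f (minusHat k L)
  Q k = + f (minusHat k η)
  Δ : (ℕ → ℤ) → ℕ → ℤ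
  Δ G k = G k + (+ 2 * + k + + 1) * G (suc k)
  A : ℤ
  A = + 2 * + part η i + + suc (length η) - + i
  0<η⋆ : All (0 <_) η
  0<η⋆ = All.++⁻ˡ η 0<ηX
  ptn : IsPartition η
  ptn = Linked-∷ʳ⁻ η (suc x) lnk , 0<η⋆
  1≤i : 1 ≤ i
  1≤i = ≤-trans (s≤s z≤n) 2≤i
  0<η : 0 < length η
  0<η = ≤-trans 1≤i i≤η
  0<L : 0 < length L
  0<L = subst (0 <_) (sym (length-up η i)) 0<η
  0<L⋆ : All (0 <_) L
  0<L⋆ = All-up η i (λ _ → s≤s z≤n) 0<η⋆
  j<η : ∀ {j} → j ≤ x → All (j <_) η
  j<η j≤x = All.map (≤-trans (s≤s j≤x)) (Linked-∷ʳ⇒All η (suc x) lnk)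
  ηᵢ<ηᵢ₋₁ : part η i < part η (i ∸ 1)
  ηᵢ<ηᵢ₋₁ = subst₂ _<_ (part-∷ʳ η (suc x) i i≤η) (part-∷ʳ η (suc x) (i ∸ 1) (≤-trans (m∸n≤m i 1) i≤η))
                      ηXᵢ<ηXᵢ₋₁
  0<ηᵢ : 0 < part η i
  0<ηᵢ = All-part η i 0<η⋆ 1≤i i≤η
  0<η₁ : 0 < length (minusHat 1 η)
  0<η₁ = minusHat-nonempty η (i ∸ 1) (≤-trans (s≤s 0<ηᵢ) ηᵢ<ηᵢ₋₁)
  0<L₁ : 0 < length (minusHat 1 L)
  0<L₁ = minusHat-nonempty L i (subst (2 ≤_) (sym (part-up η i 1≤i i≤η)) (s≤s 0<ηᵢ))

raise : ∀ t ν i → length ν ≡ t → IsPartition ν → 2 ≤ i → i ≤ t → part ν i < part ν (i ∸ 1) → RaiseIdentity ν i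
raise zero    ν (suc (suc _)) _ _ _ () _
raise (suc t) ν i |ν| ptn@(_ , 0<ν) 2≤i i≤t νᵢ<νᵢ₋₁ with initLast ν
... | η ∷ʳ′ zero    with () ∷ [] ← All.++⁻ʳ η 0<ν
... | η ∷ʳ′ suc x with m≤n⇒m<n∨m≡n i≤t
...   | inj₁ i<t = raise-∷ʳ η x i 2≤i (subst (i ≤_) (sym |η|) (≤-pred i<t)) ptn νᵢ<νᵢ₋₁
                     (λ ν′ |ν′| ptn′ → raise t ν′ i (trans |ν′| |η|) ptn′ 2≤i (≤-pred i<t))
  where
  |η| : length η ≡ t
  |η| = suc-injective (trans (sym (length-∷ʳ η (suc x))) |ν|)
...   | inj₂ refl = subst (λ n → RaiseIdentity (η ∷ʳ suc x) (suc n)) |η|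
                      (raise-last η (suc x) ptn (subst (0 <_) (sym |η|) (≤-pred 2≤i))
                        (subst (λ n → part (η ∷ʳ suc x) (suc n) < part (η ∷ʳ suc x) n) (sym |η|) νᵢ<νᵢ₋₁))
  where
  |η| : length η ≡ t
  |η| = suc-injective (trans (sym (length-∷ʳ η (suc x))) |ν|)

muIS-∷ʳ : ∀ η m i → i ≤ length η → muIS (η ∷ʳ suc m) i ≡ dropZeros (up η i ∷ʳ m)
muIS-∷ʳ η m i i≤η = cong dropZeros (trans (cong decLast (up-∷ʳ η (suc m) i i≤η)) (decLast-∷ʳ (up η i) (suc m)))

f-up-muIS : ∀ η m i → 1 ≤ i → i ≤ length η → All (0 <_) η →
  let μ = η ∷ʳ suc m in
  + f (up μ i) - + f (muIS μ i)
    ≡ (+ 2 * + m + + 1) * + f (minusHat 1 (up μ i)) - + 2 * + m * + f (minusHat 1 (muIS μ i))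
f-up-muIS η m i 1≤i i≤η 0<η⋆ = begin
  + f (up (η ∷ʳ suc m) i) - + f (muIS (η ∷ʳ suc m) i)
    ≡⟨ cong₂ _-_ (cong (λ U → + f U) (up-∷ʳ η (suc m) i i≤η)) (cong +_ f-μ⟨i,s⟩) ⟩
  + f (L ∷ʳ suc m) - + f (L ∷ʳ m)
    ≡⟨ f-∷ʳ-suc L m 0<L 0<L⋆ 0<L₁ ⟩
  (+ 2 * + m + + 1) * + f (minusHat 1 (L ∷ʳ suc m)) - + 2 * + m * + f (minusHat 1 (L ∷ʳ m))
    ≡⟨ cong₂ (λ U v → (+ 2 * + m + + 1) * + f (minusHat 1 U) - + 2 * + m * + v)
             (up-∷ʳ η (suc m) i i≤η) f-μ⟨i,s⟩-1̂ ⟨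
  (+ 2 * + m + + 1) * + f (minusHat 1 (up (η ∷ʳ suc m) i)) - + 2 * + m * + f (minusHat 1 (muIS (η ∷ʳ suc m) i)) ∎
  where
  open ≡-Reasoning
  L : List ℕ
  L = up η i
  0<L : 0 < length L
  0<L = subst (0 <_) (sym (length-up η i)) (≤-trans 1≤i i≤η)
  0<L⋆ : All (0 <_) L
  0<L⋆ = All-up η i (λ _ → s≤s z≤n) 0<η⋆
  0<L₁ : 0 < length (minusHat 1 L)
  0<L₁ = minusHat-nonempty L i (subst (2 ≤_) (sym (part-up η i 1≤i i≤η)) (s≤s (All-part η i 0<η⋆ 1≤i i≤η)))
  f-μ⟨i,s⟩ : f (muIS (η ∷ʳ suc m) i) ≡ f (L ∷ʳ m)
  f-μ⟨i,s⟩ = trans (cong f (muIS-∷ʳ η m i i≤η)) (f-dropZeros-∷ʳ L m 0<L 0<L⋆)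
  f-μ⟨i,s⟩-1̂ : f (minusHat 1 (muIS (η ∷ʳ suc m) i)) ≡ f (minusHat 1 (L ∷ʳ m))
  f-μ⟨i,s⟩-1̂ = cong f (trans (cong (minusHat 1) (muIS-∷ʳ η m i i≤η)) (minusHat-dropZeros 1 (L ∷ʳ m)))

subtract-raises : ∀ p s i m x U M W F₁ F₂ F₃ → x ≡ + 1 + m →
  U - M ≡ ((+ 2 * p + s - i) + + 1) * F₁ - (+ 2 * p + s - i) * F₂ →
  U - W ≡ (+ 2 * m + + 1) * F₁ - + 2 * m * F₃ →
  W - M ≡ (+ 2 * p - + 2 * x + s - i + + 2) * F₁ - (+ 2 * p + s - i) * F₂ + + 2 * (x - + 1) * F₃
subtract-raises p s i m _ U M W F₁ F₂ F₃ refl raiseM raiseW =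
  trans (difference U M W) (trans (cong₂ _-_ raiseM raiseW) (collect p s i m F₁ F₂ F₃))
  where
  difference : ∀ U M W → W - M ≡ (U - M) - (U - W)
  difference = solve-∀
  collect : ∀ p s i m F₁ F₂ F₃ →
    (((+ 2 * p + s - i) + + 1) * F₁ - (+ 2 * p + s - i) * F₂) - ((+ 2 * m + + 1) * F₁ - + 2 * m * F₃)
      ≡ (+ 2 * p - + 2 * (+ 1 + m) + s - i + + 2) * F₁ - (+ 2 * p + s - i) * F₂ + + 2 * ((+ 1 + m) - + 1) * F₃
  collect = solve-∀

lemma3p1 : (n : ℕ) (μ : List ℕ) (i : ℕ) →
    IsPartition μ → sum μ ≡ n →
    2 ≤ i → i < length μ →
    part μ i < part μ (i ∸ 1) →
    let s = length μ in
    (+ f (muIS μ i)) - (+ f μ)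
    ≡ ((+ 2) * (+ part μ i) - (+ 2) * (+ part μ s) + (+ s) - (+ i) + (+ 2)) * (+ f (minusHat 1 (up μ i)))
    - ((+ 2) * (+ part μ i) + (+ s) - (+ i)) * (+ f (minusHat 1 μ))
    + (+ 2) * ((+ part μ s) - (+ 1)) * (+ f (minusHat 1 (muIS μ i)))
lemma3p1 _ μ i ptn@(_ , 0<μ) _ 2≤i i<s μᵢ<μᵢ₋₁ with initLast μ
... | η ∷ʳ′ zero  with () ∷ [] ← All.++⁻ʳ η 0<μ
... | η ∷ʳ′ suc m =
  subtract-raises (+ part μ i) (+ length μ) (+ i) (+ m) (+ part μ (length μ))
    (+ f (up μ i)) (+ f μ) (+ f (muIS μ i)) (+ f (minusHat 1 (up μ i))) (+ f (minusHat 1 μ)) (+ f (minusHat 1 (muIS μ i)))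
    (cong +_ (part-∷ʳ-last η (suc m)))
    (raise (length μ) μ i refl ptn 2≤i (<⇒≤ i<s) μᵢ<μᵢ₋₁)
    (f-up-muIS η m i (≤-trans (s≤s z≤n) 2≤i) (≤-pred (subst (i <_) (length-∷ʳ η (suc m)) i<s)) (All.++⁻ˡ η 0<μ))
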